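{- Let $A \subseteq \omega$ be a crisp set, viewed as the fuzzy set $A\colon \omega \to \{0,1\} \subseteq [0;1]_{\mathbb{R}}$, and let $n \geq 1$. Then $A$ is $n$-c.e. in the classical sense if and only if $A$ is fuzzy $n$-c.e. Likewise, $A$ is co-$n$-c.e. in the classical sense if and only if $A$ is fuzzy co-$n$-c.e.
   Context: A fuzzy subset of $\omega$ is a function $A\colon \omega \to [0;1]_{\mathbb{R}}$; it is crisp if $A(x) \in \{0,1\}$ for all $x$. The complement of a fuzzy set is $\overline{A}(x) = 1 - A(x)$. $[0;1]_{\mathbb{Q}}$ denotes the rationals in $[0,1]$, coded effectively by natural numbers. Classical: a set $A \subseteq \omega$ is $n$-c.e. if there is a computable $f\colon \omega\times\omega \to \{0,1\}$ such that for all $x$: $\lim_s f(x,s) = A(x)$, $f(x,0)=0$, and $|\{s : f(x,s) \neq f(x,s+1)\}| \leq n$. $A$ is co-$n$-c.e. if $\omega\setminus A$ is $n$-c.e. For a total $f\colon \omega\times\omega \to [0;1]_{\mathbb{Q}}$, its $\Sigma$-mind change function $m^f_\Sigma\colon \omega\times\omega \to \{ -1,1\}$ is defined by: $m^f_\Sigma(x,0) = 1$; if $m^f_\Sigma(x,s)=1$, then $m^f_\Sigma(x,s+1)=1$ when $f(x,s)\leq f(x,s+1)$ and $m^f_\Sigma(x,s+1)=-1$ when $f(x,s) > f(x,s+1)$; if $m^f_\Sigma(x,s)=-1$, then $m^f_\Sigma(x,s+1)=-1$ when $f(x,s)\geq f(x,s+1)$ and $m^f_\Sigma(x,s+1)=1$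 when $f(x,s)<f(x,s+1)$. A fuzzy set $A$ is fuzzy $n$-c.e. ($n \geq 1$) if there is a computable $f\colon \omega\times\omega \to [0;1]_{\mathbb{Q}}$ such that for all $x$: $\lim_s f(x,s) = A(x)$, $f(x,0) = 0$, and $|\{s \in \omega : m^f_\Sigma(x,s+1) \neq m^f_\Sigma(x,s)\}| \leq n-1$. A fuzzy set $A$ is fuzzy co-$n$-c.e. if its complement $\overline{A}$ is fuzzy $n$-c.e. -}

module Defs where

open import Data.Nat as ℕ using (ℕ; zero; suc; _≤_; _<_; _∸_)
open import Data.Fin using (Fin)
open import Data.Vec using (Vec; []; _∷_; lookup)
open import Data.Bool using (Bool; true; false; not)
open import Data.List using (List; length)
open import Data.List.Relation.Unary.All using (All)
open import Data.List.Relation.Unary.Unique.Propositional using (Unique)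
open import Data.Product using (Σ; ∃; _×_; _,_)
open import Data.Integer using (+_)
open import Data.Rational using (ℚ; 0ℚ; 1ℚ; _-_; ∣_∣) renaming (_/_ to _/ℚ_; _≤_ to _≤ℚ_; _<_ to _<ℚ_)
open import Data.Rational.Properties using () renaming (_≤?_ to _≤ℚ?_)
open import Data.Sign using (Sign) renaming (+ to up; - to down)
open import Relation.Nullary using (¬_; Dec; yes; no)
open import Relation.Binary.PropositionalEquality using (_≡_; _≢_)

data Code : ℕ → Set where
  zeroF : ∀ {k} → Code k
  succF : Code 1
  proj  : ∀ {k} → Fin k → Code k
  comp  : ∀ {k m} → Code m → Vec (Code k) m → Code k
  prec  : ∀ {k} → Code k → Code (suc (suc k)) → Code (suc k)
  mu    : ∀ {k} → Code (suc k) → Code k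

mutual
  data _[_]⇓_ : ∀ {k} → Code k → Vec ℕ k → ℕ → Set where
    ev-zero : ∀ {k} {xs : Vec ℕ k} → zeroF [ xs ]⇓ 0
    ev-succ : ∀ {x} → succF [ x ∷ [] ]⇓ suc x
    ev-proj : ∀ {k} {i : Fin k} {xs} → proj i [ xs ]⇓ lookup xs i
    ev-comp : ∀ {k m} {f : Code m} {gs : Vec (Code k) m} {xs ys v} →
              gs [ xs ]⇓* ys → f [ ys ]⇓ v → comp f gs [ xs ]⇓ v
    ev-prec-z : ∀ {k} {g : Code k} {h xs v} →
              g [ xs ]⇓ v → prec g h [ 0 ∷ xs ]⇓ v
    ev-prec-s : ∀ {k} {g : Code k} {h y xs u v} →
              prec g h [ y ∷ xs ]⇓ u → h [ y ∷ u ∷ xs ]⇓ v →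
              prec g h [ suc y ∷ xs ]⇓ v
    ev-mu   : ∀ {k} {f : Code (suc k)} {xs y} →
              f [ y ∷ xs ]⇓ 0 →
              (∀ z → z < y → ∃ λ v → f [ z ∷ xs ]⇓ suc v) →
              mu f [ xs ]⇓ y

  data _[_]⇓*_ : ∀ {k m} → Vec (Code k) m → Vec ℕ k → Vec ℕ m → Set where
    ev-[] : ∀ {k} {xs : Vec ℕ k} → [] [ xs ]⇓* []
    ev-∷  : ∀ {k m} {g : Code k} {gs : Vec (Code k) m} {xs v vs} →
            g [ xs ]⇓ v → gs [ xs ]⇓* vs → (g ∷ gs) [ xs ]⇓* (v ∷ vs)

Computable₂ : (ℕ → ℕ → ℕ) → Set
Computable₂ g = Σ (Code 2) λ c → ∀ x s → c [ x ∷ s ∷ [] ]⇓ g x s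

bit : Bool → ℕ
bit false = 0
bit true  = 1

ComputableBool₂ : (ℕ → ℕ → Bool) → Set
ComputableBool₂ f = Computable₂ (λ x s → bit (f x s))

-- A computable function into [0;1]_ℚ: rationals are effectively coded by a
-- (numerator, denominator-1) pair of naturals, both computed by μ-recursive codes.
ComputableQ01₂ : (ℕ → ℕ → ℚ) → Set
ComputableQ01₂ f =
  Σ (ℕ → ℕ → ℕ) λ num → Σ (ℕ → ℕ → ℕ) λ den →
    Computable₂ num × Computable₂ den ×
    (∀ x s → f x s ≡ (+ num x s) /ℚ suc (den x s)) ×
    (∀ x s → 0ℚ ≤ℚ f x s × f x s ≤ℚ 1ℚ)

-- "The set {s | P s} has at most n elements".
AtMost : ℕ → (ℕ → Set) → Set
AtMost n P = ∀ (l : List ℕ) → Unique l → All P l → length l ≤ n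

NCE : ℕ → (ℕ → Bool) → Set
NCE n A = Σ (ℕ → ℕ → Bool) λ f → ComputableBool₂ f ×
  (∀ x → (Σ ℕ λ s₀ → ∀ s → s₀ ≤ s → f x s ≡ A x)
       × f x 0 ≡ false
       × AtMost n (λ s → f x s ≢ f x (suc s)))

CoNCE : ℕ → (ℕ → Bool) → Set
CoNCE n A = NCE n (λ x → not (A x))

-- Fuzzy sets (here: with rational values, enough for crisp sets).

FuzzySetℚ : Set
FuzzySetℚ = ℕ → ℚ

crisp : (ℕ → Bool) → FuzzySetℚ
crisp A x with A x
... | true  = 1ℚ
... | false = 0ℚ

complement : FuzzySetℚ → FuzzySetℚ
complement A x = 1ℚ - A x

mΣ : (ℕ → ℕ → ℚ) → ℕ → ℕ → Sign
mΣ f x zero = up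
mΣ f x (suc s) with mΣ f x s
... | up with f x s ≤ℚ? f x (suc s)
...   | yes _ = up
...   | no  _ = down
mΣ f x (suc s) | down with f x (suc s) ≤ℚ? f x s
...   | yes _ = down
...   | no  _ = up

-- lim_s f(x,s) = a  (in ℝ; a is rational here)
ConvergesTo : (ℕ → ℚ) → ℚ → Set
ConvergesTo g a = ∀ (ε : ℚ) → 0ℚ <ℚ ε →
  Σ ℕ λ s₀ → ∀ s → s₀ ≤ s → ∣ g s - a ∣ <ℚ ε

-- Fuzzy n-c.e. (meaningful for n ≥ 1): at most n-1 mind changes of mΣ.
FuzzyNCE : ℕ → FuzzySetℚ → Set
FuzzyNCE n A = Σ (ℕ → ℕ → ℚ) λ f → ComputableQ01₂ f ×
  (∀ x → ConvergesTo (f x) (A x)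
       × f x 0 ≡ 0ℚ
       × AtMost (n ∸ 1) (λ s → mΣ f x (suc s) ≢ mΣ f x s))

FuzzyCoNCE : ℕ → FuzzySetℚ → Set
FuzzyCoNCE n A = FuzzyNCE n (complement A)

module Submission where

-- A crisp approximation f of A jumps between 0 and 1; its Σ-mind changes are the reversals of
-- direction among these jumps. The first jump goes up, like the initial mode, and every later
-- jump reverses, so f has one mind change fewer than it has jumps. Conversely, from a fuzzy
-- approximation F take the crisp sequence [½ < F(x,s)]: it converges to A because F does, and
-- each of its flips is a strict move of F in the direction of the flip, which points the mode
-- that way. Consecutive flips go in opposite directions, so the mode turns between them, and
-- there is at most one flip more than there are mind changes. Complementation commutes with
-- viewing a crisp set as fuzzy, which gives the co-n-c.e. half.

open import Data.Bool using (Bool; true; false; not)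
import Data.Bool.Properties as Boolₚ
open import Data.Empty using (⊥-elim)
open import Data.Fin using () renaming (zero to #0; suc to #s)
open import Data.Integer using (+_; +<+)
import Data.Integer.Properties as ℤₚ
open import Data.List using (List; []; _∷_; length; filter; downFrom; _++_)
open import Data.List.Properties using (length-++-sucʳ)
open import Data.List.Membership.Propositional.Properties
  using (∈-∃++; ∈-++⁻; ∈-++⁺ˡ; ∈-++⁺ʳ; ∈-filter⁺; ∈-downFrom⁺)
open import Data.List.Relation.Binary.Subset.Propositional using (_⊆_)
open import Data.List.Relation.Unary.All as All using (All; []; _∷_)
open import Data.List.Relation.Unary.All.Properties using (all-filter)
open import Data.List.Relation.Unary.AllPairs using (_∷_)
open import Data.List.Relation.Unary.Any using (here; there)
open import Data.List.Relation.Unary.Unique.Propositional using (Unique)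
import Data.List.Relation.Unary.Unique.Propositional.Properties as Uniqueₚ
open import Data.Nat using (ℕ; zero; suc; pred; _+_; _*_; _∸_; _⊔_; _≤_; _<_; z≤n; s≤s)
import Data.Nat.Properties as ℕₚ
open import Data.Product using (_×_; ∃-syntax; _,_; proj₁)
open import Data.Rational using (ℚ; 0ℚ; 1ℚ; ½; ∣_∣; -_; toℚᵘ; *<*)
  renaming (_/_ to _/ℚ_; _<_ to _<ℚ_; _≤_ to _≤ℚ_; _+_ to _+ℚ_; _-_ to _-ℚ_)
import Data.Rational.Properties as ℚₚ
open import Algebra.Properties.Group ℚₚ.+-0-group using (⁻¹-involutive)
import Data.Rational.Unnormalised as ℚᵘ
import Data.Rational.Unnormalised.Properties as ℚᵘₚ
open import Data.Sign using (Sign) renaming (+ to up; - to down)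
import Data.Sign.Properties as Signₚ
open import Data.Sum using (inj₁; inj₂)
open import Data.Vec using ([]; _∷_)
open import Function using (_∘_)
open import Function.Bundles using (_⇔_; mk⇔; Equivalence)
open import Function.Construct.Composition using (_⇔-∘_)
open import Relation.Nullary using (Dec; yes; no; does; ¬?; contradiction)
open import Relation.Nullary.Decidable using (dec-true; dec-false; does-⇔)
open import Relation.Unary using (Decidable)
open import Relation.Binary.PropositionalEquality

open import Defs

countBelow : {P : ℕ → Set} → Decidable P → ℕ → ℕ
countBelow P? zero    = 0
countBelow P? (suc N) = bit (does (P? N)) + countBelow P? N

countBelow≡length-filter : {P : ℕ → Set} (P? : Decidable P) (N : ℕ) →
                           countBelow P? N ≡ length (filter P? (downFrom N))
countBelow≡length-filter P? zero = refl
countBelow≡length-filter P? (suc N) with does (P? N)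
... | true  = cong suc (countBelow≡length-filter P? N)
... | false = countBelow≡length-filter P? N

unique-⊆⇒length≤ : {A : Set} {xs ys : List A} → Unique xs → xs ⊆ ys → length xs ≤ length ys
unique-⊆⇒length≤ {xs = []} _ _ = z≤n
unique-⊆⇒length≤ {xs = x ∷ xs} (x∉xs ∷ xs!) x∷xs⊆ys
  with ys₁ , ys₂ , refl ← ∈-∃++ (x∷xs⊆ys (here refl)) = begin
    suc (length xs)            ≤⟨ s≤s (unique-⊆⇒length≤ xs! xs⊆ys₁++ys₂) ⟩
    suc (length (ys₁ ++ ys₂))  ≡⟨ length-++-sucʳ ys₁ x ys₂ ⟨
    length (ys₁ ++ x ∷ ys₂)    ∎
  where
  open ℕₚ.≤-Reasoning
  xs⊆ys₁++ys₂ : xs ⊆ ys₁ ++ ys₂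
  xs⊆ys₁++ys₂ y∈xs with ∈-++⁻ ys₁ (x∷xs⊆ys (there y∈xs))
  ... | inj₁ y∈ys₁         = ∈-++⁺ˡ y∈ys₁
  ... | inj₂ (here y≡x)    = contradiction (sym y≡x) (All.lookup x∉xs y∈xs)
  ... | inj₂ (there y∈ys₂) = ∈-++⁺ʳ ys₁ y∈ys₂

strictUpperBound : (xs : List ℕ) → ∃[ N ] All (_< N) xs
strictUpperBound [] = 0 , []
strictUpperBound (x ∷ xs) with N , xs<N ← strictUpperBound xs =
  suc x ⊔ N , ℕₚ.m≤m⊔n (suc x) N ∷ All.map (λ y<N → ℕₚ.≤-trans y<N (ℕₚ.m≤n⊔m (suc x) N)) xs<N

module _ {P : ℕ → Set} (P? : Decidable P) {n : ℕ} where

  atMost⇒countBelow≤ : AtMost n P → ∀ N → countBelow P? N ≤ n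
  atMost⇒countBelow≤ atMost N rewrite countBelow≡length-filter P? N =
    atMost (filter P? (downFrom N)) (Uniqueₚ.filter⁺ P? (Uniqueₚ.downFrom⁺ N)) (all-filter P? (downFrom N))

  countBelow≤⇒atMost : (∀ N → countBelow P? N ≤ n) → AtMost n P
  countBelow≤⇒atMost bound xs xs! Pxs with N , xs<N ← strictUpperBound xs = begin
    length xs                        ≤⟨ unique-⊆⇒length≤ xs! xs⊆ ⟩
    length (filter P? (downFrom N))  ≡⟨ countBelow≡length-filter P? N ⟨
    countBelow P? N                  ≤⟨ bound N ⟩
    n                                ∎
    where
    open ℕₚ.≤-Reasoning
    xs⊆ : xs ⊆ filter P? (downFrom N)
    xs⊆ y∈xs = ∈-filter⁺ P? (∈-downFrom⁺ (All.lookup xs<N y∈xs)) (All.lookup Pxs y∈xs)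

flip? : (b : ℕ → Bool) → Decidable (λ s → b s ≢ b (suc s))
flip? b s = ¬? (b s Boolₚ.≟ b (suc s))

turn? : (m : ℕ → Sign) → Decidable (λ s → m (suc s) ≢ m s)
turn? m s = ¬? (m (suc s) Signₚ.≟ m s)

flips : (ℕ → Bool) → ℕ → ℕ
flips b = countBelow (flip? b)

turns : (ℕ → Sign) → ℕ → ℕ
turns m = countBelow (turn? m)

towards : Bool → Sign
towards false = down
towards true  = up

FollowsFlips : (ℕ → Bool) → (ℕ → Sign) → Set
FollowsFlips b m = ∀ s → b s ≢ b (suc s) → m (suc s) ≡ towards (b (suc s))

TurnsOnlyAtFlips : (ℕ → Bool) → (ℕ → Sign) → Set
TurnsOnlyAtFlips b m = ∀ s → b s ≡ b (suc s) → m (suc s) ≡ m s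

data Phase : Bool → Sign → (flips turns : ℕ) → Set where
  unflipped : Phase false up 0 0
  flipped   : ∀ {b t} → Phase b (towards b) (suc t) t

phase-step : ∀ {b₀ m₀ p q} b₁ m₁ → Phase b₀ m₀ p q →
             (b₀ ≢ b₁ → m₁ ≡ towards b₁) → (b₀ ≡ b₁ → m₁ ≡ m₀) →
             Phase b₁ m₁ (bit (does (¬? (b₀ Boolₚ.≟ b₁))) + p) (bit (does (¬? (m₁ Signₚ.≟ m₀))) + q)
phase-step false m₁ unflipped _ steady rewrite steady refl = unflipped
phase-step true  m₁ unflipped flip _   rewrite flip (λ ())  = flipped
phase-step {b₀ = false} false m₁ flipped _ steady rewrite steady refl = flipped
phase-step {b₀ = true}  true  m₁ flipped _ steady rewrite steady refl = flipped
phase-step {b₀ = false} true  m₁ flipped flip _ rewrite flip (λ ()) = flipped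
phase-step {b₀ = true}  false m₁ flipped flip _ rewrite flip (λ ()) = flipped

turns≡flips∸1 : ∀ {b m} → b 0 ≡ false → m 0 ≡ up → FollowsFlips b m → TurnsOnlyAtFlips b m →
                ∀ N → turns m N ≡ flips b N ∸ 1
turns≡flips∸1 {b} {m} b₀≡false m₀≡up follows steady N = phase⇒ (phase N)
  where
  phase : ∀ s → Phase (b s) (m s) (flips b s) (turns m s)
  phase zero rewrite b₀≡false | m₀≡up = unflipped
  phase (suc s) = phase-step (b (suc s)) (m (suc s)) (phase s) (follows s) (steady s)
  phase⇒ : ∀ {b m p q} → Phase b m p q → q ≡ p ∸ 1
  phase⇒ unflipped = refl
  phase⇒ flipped   = refl

-- A flip away from b costs no turn exactly when m already points towards not b.
credit : Bool → Sign → ℕ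
credit false up   = 1
credit true  down = 1
credit false down = 0
credit true  up   = 0

credit-step : ∀ b₀ b₁ m₀ m₁ {p q} → credit b₀ m₀ + p ≤ suc q → (b₀ ≢ b₁ → m₁ ≡ towards b₁) →
              credit b₁ m₁ + (bit (does (¬? (b₀ Boolₚ.≟ b₁))) + p)
                ≤ suc (bit (does (¬? (m₁ Signₚ.≟ m₀))) + q)
credit-step false false up   up   i _ = i
credit-step false false up   down i _ = ℕₚ.m<n⇒m≤1+n i
credit-step false false down up   i _ = s≤s i
credit-step false false down down i _ = i
credit-step true  true  up   up   i _ = i
credit-step true  true  up   down i _ = s≤s i
credit-step true  true  down up   i _ = ℕₚ.m<n⇒m≤1+n i
credit-step true  true  down down i _ = i
credit-step false true  up   up   i _ = i
credit-step false true  down up   i _ = s≤s i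
credit-step true  false down down i _ = i
credit-step true  false up   down i _ = s≤s i
credit-step false true  _    down _ flip with () ← flip (λ ())
credit-step true  false _    up   _ flip with () ← flip (λ ())

flips≤1+turns : ∀ {b m} → b 0 ≡ false → m 0 ≡ up → FollowsFlips b m →
                ∀ N → flips b N ≤ suc (turns m N)
flips≤1+turns {b} {m} b₀≡false m₀≡up follows N =
  ℕₚ.≤-trans (ℕₚ.m≤n+m (flips b N) (credit (b N) (m N))) (invariant N)
  where
  invariant : ∀ s → credit (b s) (m s) + flips b s ≤ suc (turns m s)
  invariant zero rewrite b₀≡false | m₀≡up = s≤s z≤n
  invariant (suc s) = credit-step (b s) (b (suc s)) (m s) (m (suc s)) (invariant s) (follows s)

module _ (f : ℕ → ℕ → ℚ) (x : ℕ) where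

  mΣ-rise : ∀ s → f x s <ℚ f x (suc s) → mΣ f x (suc s) ≡ up
  mΣ-rise s fs<fs' with mΣ f x s
  ... | up with f x s ℚₚ.≤? f x (suc s)
  ...   | yes _     = refl
  ...   | no fs≰fs' = contradiction (ℚₚ.<⇒≤ fs<fs') fs≰fs'
  mΣ-rise s fs<fs' | down with f x (suc s) ℚₚ.≤? f x s
  ...   | yes fs'≤fs = ⊥-elim (ℚₚ.<-irrefl refl (ℚₚ.<-≤-trans fs<fs' fs'≤fs))
  ...   | no _       = refl

  mΣ-fall : ∀ s → f x (suc s) <ℚ f x s → mΣ f x (suc s) ≡ down
  mΣ-fall s fs'<fs with mΣ f x s
  ... | up with f x s ℚₚ.≤? f x (suc s)
  ...   | yes fs≤fs' = ⊥-elim (ℚₚ.<-irrefl refl (ℚₚ.<-≤-trans fs'<fs fs≤fs'))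
  ...   | no _       = refl
  mΣ-fall s fs'<fs | down with f x (suc s) ℚₚ.≤? f x s
  ...   | yes _     = refl
  ...   | no fs'≰fs = contradiction (ℚₚ.<⇒≤ fs'<fs) fs'≰fs

  mΣ-steady : ∀ s → f x s ≡ f x (suc s) → mΣ f x (suc s) ≡ mΣ f x s
  mΣ-steady s fs≡fs' with mΣ f x s
  ... | up with f x s ℚₚ.≤? f x (suc s)
  ...   | yes _     = refl
  ...   | no fs≰fs' = contradiction (ℚₚ.≤-reflexive fs≡fs') fs≰fs'
  mΣ-steady s fs≡fs' | down with f x (suc s) ℚₚ.≤? f x s
  ...   | yes _     = refl
  ...   | no fs'≰fs = contradiction (ℚₚ.≤-reflexive (sym fs≡fs')) fs'≰fs

  mΣ-follows-threshold : ∀ c {b} → (∀ s → b s ≡ does (c ℚₚ.<? f x s)) → FollowsFlips b (mΣ f x)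
  mΣ-follows-threshold c {b} b≡ s bs≢bs' =
    trans (follows (c ℚₚ.<? f x s) (c ℚₚ.<? f x (suc s))
                   (λ e → bs≢bs' (trans (b≡ s) (trans e (sym (b≡ (suc s)))))))
          (cong towards (sym (b≡ (suc s))))
    where
    follows : (c<fs? : Dec (c <ℚ f x s)) (c<fs'? : Dec (c <ℚ f x (suc s))) →
              does c<fs? ≢ does c<fs'? → mΣ f x (suc s) ≡ towards (does c<fs'?)
    follows (yes _)    (yes _)     flip = contradiction refl flip
    follows (no _)     (no _)      flip = contradiction refl flip
    follows (no c≮fs)  (yes c<fs') _    = mΣ-rise s (ℚₚ.≤-<-trans (ℚₚ.≮⇒≥ c≮fs) c<fs')
    follows (yes c<fs) (no c≮fs')  _    = mΣ-fall s (ℚₚ.≤-<-trans (ℚₚ.≮⇒≥ c≮fs') c<fs)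

computable-∘₁ : ∀ {h : ℕ → ℕ} {g : ℕ → ℕ → ℕ} (c : Code 1) → (∀ a → c [ a ∷ [] ]⇓ h a) →
                Computable₂ g → Computable₂ (λ x s → h (g x s))
computable-∘₁ c c⇓ (cg , cg⇓) = comp c (cg ∷ []) , λ x s → ev-comp (ev-∷ (cg⇓ x s) ev-[]) (c⇓ _)

computable-∘₂ : ∀ {h : ℕ → ℕ → ℕ} {g₁ g₂ : ℕ → ℕ → ℕ} (c : Code 2) → (∀ a b → c [ a ∷ b ∷ [] ]⇓ h a b) →
                Computable₂ g₁ → Computable₂ g₂ → Computable₂ (λ x s → h (g₁ x s) (g₂ x s))
computable-∘₂ c c⇓ (c₁ , c₁⇓) (c₂ , c₂⇓) =
  comp c (c₁ ∷ c₂ ∷ []) , λ x s → ev-comp (ev-∷ (c₁⇓ x s) (ev-∷ (c₂⇓ x s) ev-[])) (c⇓ _ _)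

pred-code : Code 1
pred-code = prec zeroF (proj #0)

pred-code⇓ : ∀ a → pred-code [ a ∷ [] ]⇓ pred a
pred-code⇓ zero    = ev-prec-z ev-zero
pred-code⇓ (suc a) = ev-prec-s (pred-code⇓ a) ev-proj

monus-code : Code 2
monus-code = prec (proj #0) (comp pred-code (proj (#s #0) ∷ []))

monus-code⇓ : ∀ a b → monus-code [ a ∷ b ∷ [] ]⇓ (b ∸ a)
monus-code⇓ zero    b = ev-prec-z ev-proj
monus-code⇓ (suc a) b = subst (monus-code [ suc a ∷ b ∷ [] ]⇓_) (ℕₚ.pred[m∸n]≡m∸[1+n] b a)
  (ev-prec-s (monus-code⇓ a b) (ev-comp (ev-∷ ev-proj ev-[]) (pred-code⇓ (b ∸ a))))

add-code : Code 2
add-code = prec (proj #0) (comp succF (proj (#s #0) ∷ []))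

add-code⇓ : ∀ a b → add-code [ a ∷ b ∷ [] ]⇓ (a + b)
add-code⇓ zero    b = ev-prec-z ev-proj
add-code⇓ (suc a) b = ev-prec-s (add-code⇓ a b) (ev-comp (ev-∷ ev-proj ev-[]) ev-succ)

positive-code : Code 1
positive-code = prec zeroF (comp succF (zeroF ∷ []))

positive-code⇓ : ∀ a → positive-code [ a ∷ [] ]⇓ bit (does (0 ℕₚ.<? a))
positive-code⇓ zero    = ev-prec-z ev-zero
positive-code⇓ (suc a) = ev-prec-s (positive-code⇓ a) (ev-comp (ev-∷ ev-zero ev-[]) ev-succ)

m<n⇔0<n∸m : ∀ {m n} → m < n ⇔ 0 < n ∸ m
m<n⇔0<n∸m = mk⇔ ℕₚ.m<n⇒0<n∸m (ℕₚ.m∸n≢0⇒n<m ∘ ℕₚ.n>0⇒n≢0)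

½<a/[1+d]⇔1+d<a+a : ∀ a d → ½ <ℚ (+ a) /ℚ suc d ⇔ suc d < a + a
½<a/[1+d]⇔1+d<a+a a d = mk⇔ to from
  where
  a/[1+d]≃ : toℚᵘ ((+ a) /ℚ suc d) ℚᵘ.≃ ℚᵘ.mkℚᵘ (+ a) d
  a/[1+d]≃ = ℚₚ.toℚᵘ-fromℚᵘ (ℚᵘ.mkℚᵘ (+ a) d)
  1*[1+d]≡1+d : 1 * suc d ≡ suc d
  1*[1+d]≡1+d = ℕₚ.*-identityˡ (suc d)
  a*2≡a+a : a * 2 ≡ a + a
  a*2≡a+a = trans (ℕₚ.*-comm a 2) (cong (λ k → a + k) (ℕₚ.+-identityʳ a))
  to : ½ <ℚ (+ a) /ℚ suc d → suc d < a + a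
  to ½<a/[1+d] with ℚᵘₚ.<-respʳ-≃ a/[1+d]≃ (ℚₚ.toℚᵘ-mono-< ½<a/[1+d])
  ... | ℚᵘ.*<* lt = subst₂ _<_ 1*[1+d]≡1+d a*2≡a+a (ℤₚ.+◃-cancel-< lt)
  from : suc d < a + a → ½ <ℚ (+ a) /ℚ suc d
  from lt = ℚₚ.toℚᵘ-cancel-< (ℚᵘₚ.<-respʳ-≃ (ℚᵘₚ.≃-sym a/[1+d]≃)
    (ℚᵘ.*<* (ℤₚ.+◃-mono-< (subst₂ _<_ (sym 1*[1+d]≡1+d) (sym a*2≡a+a) lt))))

threshold-computable : ∀ {F} → ComputableQ01₂ F → ComputableBool₂ (λ x s → does (½ ℚₚ.<? F x s))
threshold-computable {F} (num , den , num-computable , den-computable , F≡ , _)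
  with code , code⇓ ← computable-∘₁ positive-code positive-code⇓
                        (computable-∘₂ monus-code monus-code⇓
                          (computable-∘₁ succF (λ _ → ev-succ) den-computable)
                          (computable-∘₂ add-code add-code⇓ num-computable num-computable))
  = code , λ x s → subst (code [ x ∷ s ∷ [] ]⇓_)
                         (cong bit (sym (does-⇔ (½<F⇔ x s) (½ ℚₚ.<? F x s) (0 ℕₚ.<? _))))
                         (code⇓ x s)
  where
  ½<F⇔ : ∀ x s → ½ <ℚ F x s ⇔ 0 < (num x s + num x s) ∸ suc (den x s)
  ½<F⇔ x s = subst (λ q → ½ <ℚ q ⇔ _) (sym (F≡ x s))
                   (m<n⇔0<n∸m ⇔-∘ ½<a/[1+d]⇔1+d<a+a (num x s) (den x s))

boolℚ : Bool → ℚ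
boolℚ false = 0ℚ
boolℚ true  = 1ℚ

crisp≡boolℚ : ∀ A x → crisp A x ≡ boolℚ (A x)
crisp≡boolℚ A x with A x
... | true  = refl
... | false = refl

crisp-not≡complement : ∀ A x → crisp (not ∘ A) x ≡ complement (crisp A) x
crisp-not≡complement A x with A x
... | true  = refl
... | false = refl

boolℚ-threshold : ∀ v → v ≡ does (½ ℚₚ.<? boolℚ v)
boolℚ-threshold false = refl
boolℚ-threshold true  = refl

boolℚ-computable : ∀ {f} → ComputableBool₂ f → ComputableQ01₂ (λ x s → boolℚ (f x s))
boolℚ-computable {f} f-computable =
  (λ x s → bit (f x s)) , (λ _ _ → 0) , f-computable , (zeroF , λ _ _ → ev-zero) ,
  (λ x s → boolℚ≡bit/1 (f x s)) , (λ x s → boolℚ∈[0,1] (f x s))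
  where
  boolℚ≡bit/1 : ∀ v → boolℚ v ≡ (+ bit v) /ℚ 1
  boolℚ≡bit/1 false = refl
  boolℚ≡bit/1 true  = refl
  boolℚ∈[0,1] : ∀ v → 0ℚ ≤ℚ boolℚ v × boolℚ v ≤ℚ 1ℚ
  boolℚ∈[0,1] false = ℚₚ.≤-refl , ℚₚ.nonNegative⁻¹ 1ℚ
  boolℚ∈[0,1] true  = ℚₚ.nonNegative⁻¹ 1ℚ , ℚₚ.≤-refl

0<½ : 0ℚ <ℚ ½
0<½ = ℚₚ.positive⁻¹ ½

eventually-constant⇒converges : ∀ {g : ℕ → ℚ} {a} s₀ → (∀ s → s₀ ≤ s → g s ≡ a) → ConvergesTo g a
eventually-constant⇒converges {a = a} s₀ g≡a ε 0<ε = s₀ , λ s s₀≤s →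
  subst (λ q → ∣ q -ℚ a ∣ <ℚ ε) (sym (g≡a s s₀≤s)) (subst (λ q → ∣ q ∣ <ℚ ε) (sym (ℚₚ.+-inverseʳ a)) 0<ε)

½<1 : ½ <ℚ 1ℚ
½<1 = *<* (+<+ (s≤s (s≤s z≤n)))

p-1+1≡p : ∀ {p} → (p -ℚ 1ℚ) +ℚ 1ℚ ≡ p
p-1+1≡p {p} = begin
  (p -ℚ 1ℚ) +ℚ 1ℚ     ≡⟨ ℚₚ.+-assoc p (- 1ℚ) 1ℚ ⟩
  p +ℚ (- 1ℚ +ℚ 1ℚ)   ≡⟨ cong (p +ℚ_) (ℚₚ.+-inverseˡ 1ℚ) ⟩
  p +ℚ 0ℚ             ≡⟨ ℚₚ.+-identityʳ p ⟩
  p                   ∎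
  where open ≡-Reasoning

∣p-1∣<½⇒½<p : ∀ p → ∣ p -ℚ 1ℚ ∣ <ℚ ½ → ½ <ℚ p
∣p-1∣<½⇒½<p p ∣p-1∣<½ with ℚₚ.∣p∣≡p∨∣p∣≡-p (p -ℚ 1ℚ)
... | inj₁ ∣p-1∣≡p-1 = begin-strict
  ½                 <⟨ ½<1 ⟩
  1ℚ                ≤⟨ ℚₚ.+-monoˡ-≤ 1ℚ (ℚₚ.∣p∣≡p⇒0≤p ∣p-1∣≡p-1) ⟩
  (p -ℚ 1ℚ) +ℚ 1ℚ   ≡⟨ p-1+1≡p ⟩
  p                 ∎
  where open ℚₚ.≤-Reasoning
... | inj₂ ∣p-1∣≡1-p = begin-strict
  ½                 <⟨ ℚₚ.+-monoˡ-< 1ℚ -½<p-1 ⟩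
  (p -ℚ 1ℚ) +ℚ 1ℚ   ≡⟨ p-1+1≡p ⟩
  p                 ∎
  where
  open ℚₚ.≤-Reasoning
  -½<p-1 : - ½ <ℚ p -ℚ 1ℚ
  -½<p-1 = subst (- ½ <ℚ_) (⁻¹-involutive (p -ℚ 1ℚ))
                 (ℚₚ.neg-antimono-< (subst (_<ℚ ½) ∣p-1∣≡1-p ∣p-1∣<½))

∣p-0∣<½⇒p<½ : ∀ {p} → 0ℚ ≤ℚ p → ∣ p -ℚ 0ℚ ∣ <ℚ ½ → p <ℚ ½
∣p-0∣<½⇒p<½ {p} 0≤p = subst (_<ℚ ½) (trans (cong ∣_∣ (ℚₚ.+-identityʳ p)) (ℚₚ.0≤p⇒∣p∣≡p 0≤p))

threshold-stabilises : ∀ {g : ℕ → ℚ} v → (∀ s → 0ℚ ≤ℚ g s) → ConvergesTo g (boolℚ v) →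
                       ∃[ s₀ ] ∀ s → s₀ ≤ s → does (½ ℚₚ.<? g s) ≡ v
threshold-stabilises {g} true _ g→1 with s₀ , close ← g→1 ½ 0<½ =
  s₀ , λ s s₀≤s → dec-true (½ ℚₚ.<? g s) (∣p-1∣<½⇒½<p (g s) (close s s₀≤s))
threshold-stabilises {g} false 0≤g g→0 with s₀ , close ← g→0 ½ 0<½ =
  s₀ , λ s s₀≤s → dec-false (½ ℚₚ.<? g s) (ℚₚ.<-asym (∣p-0∣<½⇒p<½ (0≤g s) (close s s₀≤s)))

NCE⇒FuzzyNCE : ∀ n A → NCE n A → FuzzyNCE n (crisp A)
NCE⇒FuzzyNCE n A (f , f-computable , spec) = F , boolℚ-computable f-computable , λ x →
  let (s₀ , f→A) , f₀≡false , flipsAtMost = spec x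
      follows = mΣ-follows-threshold F x ½ (λ s → boolℚ-threshold (f x s))
      steady  = λ s e → mΣ-steady F x s (cong boolℚ e)
  in eventually-constant⇒converges s₀
       (λ s s₀≤s → trans (cong boolℚ (f→A s s₀≤s)) (sym (crisp≡boolℚ A x))) ,
     cong boolℚ f₀≡false ,
     countBelow≤⇒atMost (turn? (mΣ F x)) λ N → begin
       turns (mΣ F x) N  ≡⟨ turns≡flips∸1 f₀≡false refl follows steady N ⟩
       flips (f x) N ∸ 1 ≤⟨ ℕₚ.∸-monoˡ-≤ 1 (atMost⇒countBelow≤ (flip? (f x)) flipsAtMost N) ⟩
       n ∸ 1             ∎
  where
  open ℕₚ.≤-Reasoning
  F : ℕ → ℕ → ℚ
  F x s = boolℚ (f x s)

FuzzyNCE⇒NCE : ∀ n → 1 ≤ n → ∀ A → FuzzyNCE n (crisp A) → NCE n A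
FuzzyNCE⇒NCE n 1≤n A (F , F-computable@(_ , _ , _ , _ , _ , F∈[0,1]) , spec) =
  b , threshold-computable F-computable , λ x →
  let F→A , F₀≡0 , turnsAtMost = spec x
      b₀≡false = dec-false (½ ℚₚ.<? F x 0) (λ ½<F₀ → ℚₚ.<-asym ½<F₀ (subst (_<ℚ ½) (sym F₀≡0) 0<½))
  in threshold-stabilises (A x) (λ s → proj₁ (F∈[0,1] x s))
                          (subst (ConvergesTo (F x)) (crisp≡boolℚ A x) F→A) ,
     b₀≡false ,
     countBelow≤⇒atMost (flip? (b x)) λ N → begin
       flips (b x) N          ≤⟨ flips≤1+turns b₀≡false refl (mΣ-follows-threshold F x ½ (λ _ → refl)) N ⟩
       suc (turns (mΣ F x) N) ≤⟨ s≤s (atMost⇒countBelow≤ (turn? (mΣ F x)) turnsAtMost N) ⟩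
       suc (n ∸ 1)            ≡⟨ ℕₚ.m+[n∸m]≡n 1≤n ⟩
       n                      ∎
  where
  open ℕₚ.≤-Reasoning
  b : ℕ → ℕ → Bool
  b x s = does (½ ℚₚ.<? F x s)

FuzzyNCE-resp : ∀ {n B C} → (∀ x → B x ≡ C x) → FuzzyNCE n B → FuzzyNCE n C
FuzzyNCE-resp B≡C (f , f-computable , spec) = f , f-computable , λ x →
  let f→B , rest = spec x in subst (ConvergesTo (f x)) (B≡C x) f→B , rest

proposition4 : ∀ (n : ℕ) → 1 ≤ n → ∀ (A : ℕ → Bool) →
    (NCE n A ⇔ FuzzyNCE n (crisp A)) × (CoNCE n A ⇔ FuzzyCoNCE n (crisp A))
proposition4 n 1≤n A =
  NCE⇔FuzzyNCE A ,
  mk⇔ (FuzzyNCE-resp {n} (crisp-not≡complement A) ∘ Equivalence.to (NCE⇔FuzzyNCE (not ∘ A)))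
      (Equivalence.from (NCE⇔FuzzyNCE (not ∘ A)) ∘ FuzzyNCE-resp {n} (sym ∘ crisp-not≡complement A))
  where
  NCE⇔FuzzyNCE : ∀ B → NCE n B ⇔ FuzzyNCE n (crisp B)
  NCE⇔FuzzyNCE B = mk⇔ (NCE⇒FuzzyNCE n B) (FuzzyNCE⇒NCE n 1≤n B)
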